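{- For every integer $q\ge 2$, $\theta(\overline{KE_q})=\alpha(\overline{KE_q})=2q$.
   Context: For $q\ge 1$, $\overline{KE_q}$ is the graph with the $6q$ vertices $v_{i1},v_{i2},v_{i3}$ ($i=1,\dots,2q$), whose edges are: the edges of the Hamiltonian cycle $v_{11},v_{12},v_{13},v_{21},v_{22},v_{23},\dots,v_{2q\,1},v_{2q\,2},v_{2q\,3},v_{11}$; the edges $v_{i1}v_{i3}$ for $i=1,\dots,2q$ (so each $\{v_{i1},v_{i2},v_{i3}\}$ is a triangle); and the edges $v_{i2}v_{i+q\,2}$ for $i=1,\dots,q$. It has $9q$ edges. $\theta(H)$ is the clique partition number (minimum number of cliques partitioning $V(H)$) and $\alpha(H)$ the maximum size of an independent set. -}

module Defs where

open import Data.Nat using (ℕ; zero; suc; _+_; _*_; _≤_; _<_)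
open import Data.Fin using (Fin; toℕ)
open import Data.Fin.Subset using (Subset; _∈_; ∣_∣)
open import Data.Product using (Σ; ∃; _×_; _,_)
open import Data.Sum using (_⊎_)
open import Relation.Nullary using (¬_)
open import Relation.Binary.PropositionalEquality using (_≡_; _≢_)
open import Function.Definitions using (Surjective)

-- A clique partition of V into exactly k (nonempty) cliques: a surjective
-- labelling c : Fin n → Fin k whose classes are cliques.
IsCliquePartition : {n : ℕ} → (Fin n → Fin n → Set) → (k : ℕ) → (Fin n → Fin k) → Set
IsCliquePartition {n} Adj k c =
  Surjective _≡_ _≡_ c × (∀ (x y : Fin n) → x ≢ y → c x ≡ c y → Adj x y)

HasCliquePartition : {n : ℕ} → (Fin n → Fin n → Set) → ℕ → Set
HasCliquePartition {n} Adj k = Σ (Fin n → Fin k) λ c → IsCliquePartition Adj k c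

CliquePartitionNumber : {n : ℕ} → (Fin n → Fin n → Set) → ℕ → Set
CliquePartitionNumber Adj t =
  HasCliquePartition Adj t × (∀ k → HasCliquePartition Adj k → t ≤ k)

IsIndependent : {n : ℕ} → (Fin n → Fin n → Set) → Subset n → Set
IsIndependent {n} Adj S = ∀ (x y : Fin n) → x ∈ S → y ∈ S → ¬ Adj x y

IndependenceNumber : {n : ℕ} → (Fin n → Fin n → Set) → ℕ → Set
IndependenceNumber {n} Adj t =
  (Σ (Subset n) λ S → IsIndependent Adj S × ∣ S ∣ ≡ t)
  × (∀ (S : Subset n) → IsIndependent Adj S → ∣ S ∣ ≤ t)

-- The graph  KE_q-bar  on 6q vertices.
-- Vertex v_{i j} (i = 1..2q, j = 1..3) is encoded as the natural number
-- 3(i-1) + (j-1), so the Hamiltonian cycle is 0,1,2,...,6q-1,0.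

data KEEdge (q : ℕ) : ℕ → ℕ → Set where
  cyc   : ∀ a → suc a < 6 * q → KEEdge q a (suc a)
  close : ∀ a → suc a ≡ 6 * q → KEEdge q a 0
  tri   : ∀ i → i < 2 * q → KEEdge q (3 * i) (3 * i + 2)
  mat   : ∀ i → i < q → KEEdge q (3 * i + 1) (3 * (i + q) + 1)

KEbar : (q : ℕ) → Fin (6 * q) → Fin (6 * q) → Set
KEbar q x y = KEEdge q (toℕ x) (toℕ y) ⊎ KEEdge q (toℕ y) (toℕ x)

-- The 2q triangles {v_i1, v_i2, v_i3} partition the vertices into cliques, and the 2q
-- vertices v_i1 (the multiples of 3 in the numbering of the Hamiltonian cycle) are pairwise
-- non-adjacent: consecutive cycle vertices are never both multiples of 3, and the chords and
-- matching edges each have an endpoint v_i2 or v_i3.  In any graph a clique partition meets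
-- an independent set at most once per class, so |S| ≤ k for every independent set S and
-- clique partition into k classes; equality at 2q pins down both θ and α.
module Submission where

open import Defs
open import Data.Nat using (ℕ; zero; suc; _+_; _*_; _≤_; _<_; z≤n; s≤s)
open import Data.Nat.Properties using (+-comm; *-comm; *-assoc; <⇒≤; *-monoˡ-≤; *-monoˡ-<)
open import Data.Nat.DivMod using (_/_; _mod_; _divMod_; m*n/n≡m; m<n*o⇒m/o<n; module DivMod)
open import Data.Nat.Divisibility
  using (_∣_; _∣?_; _∣0; ∣-refl; ∣m∣n⇒∣m+n; ∣m+n∣m⇒∣n; m∣m*n; n∣m*n)
open import Data.Fin using (Fin; zero; suc; toℕ; fromℕ<; punchOut)
open import Data.Fin.Properties
  using (_≟_; toℕ-fromℕ<; toℕ-injective; toℕ<n; punchOut-injective; suc-injective)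
open import Data.Fin.Subset using (Subset; _∈_; ∣_∣; inside; outside)
open import Data.Vec using (_∷_; []; here; there)
open import Data.Product using (_×_; _,_; proj₂)
open import Data.Sum using (_⊎_; inj₁; inj₂)
open import Relation.Nullary using (¬_; yes; no; contradiction)
open import Relation.Nullary.Decidable using (from-no)
open import Relation.Binary.PropositionalEquality
  using (_≡_; _≢_; refl; sym; trans; cong; subst; subst₂; module ≡-Reasoning)
open import Function using (_∘_)
open import Function.Definitions using (Surjective)

injection⇒∣p∣≤m : ∀ {m n} (p : Subset n) (f : ∀ x → x ∈ p → Fin m) →
                  (∀ {x y} px py → f x px ≡ f y py → x ≡ y) → ∣ p ∣ ≤ m
injection⇒∣p∣≤m [] f f-inj = z≤n
injection⇒∣p∣≤m (outside ∷ p) f f-inj =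
  injection⇒∣p∣≤m p (λ x px → f (suc x) (there px)) (λ px py e → suc-injective (f-inj _ _ e))
injection⇒∣p∣≤m {zero} (inside ∷ p) f f-inj with f zero here
... | ()
injection⇒∣p∣≤m {suc m} (inside ∷ p) f f-inj = s≤s (injection⇒∣p∣≤m p g g-inj)
  where
  f₀≢f : ∀ x (px : x ∈ p) → f zero here ≢ f (suc x) (there px)
  f₀≢f x px e with () ← f-inj here (there px) e
  g : ∀ x → x ∈ p → Fin m
  g x px = punchOut (f₀≢f x px)
  g-inj : ∀ {x y} px py → g x px ≡ g y py → x ≡ y
  g-inj px py e = suc-injective (f-inj _ _ (punchOut-injective (f₀≢f _ px) (f₀≢f _ py) e))

module _ {n : ℕ} (Adj : Fin n → Fin n → Set) where

  ∣independent∣≤#cliques : ∀ {k} {S : Subset n} {c : Fin n → Fin k} →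
                           IsIndependent Adj S → (∀ x y → x ≢ y → c x ≡ c y → Adj x y) →
                           ∣ S ∣ ≤ k
  ∣independent∣≤#cliques {S = S} {c} S-ind c-cliques =
    injection⇒∣p∣≤m S (λ x _ → c x) c-injectiveOn-S
    where
    c-injectiveOn-S : ∀ {x y} → x ∈ S → y ∈ S → c x ≡ c y → x ≡ y
    c-injectiveOn-S {x} {y} x∈S y∈S cx≡cy with x ≟ y
    ... | yes x≡y = x≡y
    ... | no x≢y = contradiction (c-cliques x y x≢y cx≡cy) (S-ind x y x∈S y∈S)

  independent∧cliquePartition⇒θ∧α : ∀ {t} {S : Subset n} {c : Fin n → Fin t} →
                                    IsIndependent Adj S → ∣ S ∣ ≡ t → IsCliquePartition Adj t c →
                                    CliquePartitionNumber Adj t × IndependenceNumber Adj t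
  independent∧cliquePartition⇒θ∧α {t} {S} {c} S-ind ∣S∣≡t c-part =
    ((c , c-part) , θ-minimal) , ((S , S-ind , ∣S∣≡t) , α-maximal)
    where
    θ-minimal : ∀ k → HasCliquePartition Adj k → t ≤ k
    θ-minimal k (c′ , _ , c′-cliques) =
      subst (_≤ k) ∣S∣≡t (∣independent∣≤#cliques S-ind c′-cliques)
    α-maximal : ∀ S′ → IsIndependent Adj S′ → ∣ S′ ∣ ≤ t
    α-maximal S′ S′-ind = ∣independent∣≤#cliques S′-ind (proj₂ c-part)

KEAdj : ℕ → ℕ → ℕ → Set
KEAdj q m n = KEEdge q m n ⊎ KEEdge q n m

6q≡2q*3 : ∀ q → 6 * q ≡ 2 * q * 3
6q≡2q*3 q = trans (*-assoc 3 2 q) (*-comm 3 (2 * q))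

¬3∣1 : ¬ 3 ∣ 1
¬3∣1 = from-no (3 ∣? 1)

¬3∣2 : ¬ 3 ∣ 2
¬3∣2 = from-no (3 ∣? 2)

3∣m⇒¬3∣1+m : ∀ {m} → 3 ∣ m → ¬ 3 ∣ suc m
3∣m⇒¬3∣1+m {m} 3∣m 3∣1+m = ¬3∣1 (∣m+n∣m⇒∣n (subst (3 ∣_) (+-comm 1 m) 3∣1+m) 3∣m)

KEEdge⇒¬3∣both : ∀ {q m n} → KEEdge q m n → 3 ∣ m → ¬ 3 ∣ n
KEEdge⇒¬3∣both (cyc a _) 3∣a = 3∣m⇒¬3∣1+m 3∣a
KEEdge⇒¬3∣both {q} (close a 1+a≡6q) 3∣a _ =
  3∣m⇒¬3∣1+m 3∣a (subst (3 ∣_) (trans (sym (6q≡2q*3 q)) (sym 1+a≡6q)) (n∣m*n (2 * q)))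
KEEdge⇒¬3∣both (tri i _) _ 3∣3i+2 = ¬3∣2 (∣m+n∣m⇒∣n 3∣3i+2 (m∣m*n i))
KEEdge⇒¬3∣both (mat i _) 3∣3i+1 _ = ¬3∣1 (∣m+n∣m⇒∣n 3∣3i+1 (m∣m*n i))

multiplesOf3 : ∀ n → Subset n
multiplesOf3 0 = []
multiplesOf3 1 = inside ∷ []
multiplesOf3 2 = inside ∷ outside ∷ []
multiplesOf3 (suc (suc (suc n))) = inside ∷ outside ∷ outside ∷ multiplesOf3 n

∈multiplesOf3⇒3∣ : ∀ {n} {x : Fin n} → x ∈ multiplesOf3 n → 3 ∣ toℕ x
∈multiplesOf3⇒3∣ {1} here = 3 ∣0
∈multiplesOf3⇒3∣ {2} here = 3 ∣0
∈multiplesOf3⇒3∣ {2} (there (there ()))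
∈multiplesOf3⇒3∣ {suc (suc (suc n))} here = 3 ∣0
∈multiplesOf3⇒3∣ {suc (suc (suc n))} (there (there (there x∈))) =
  ∣m∣n⇒∣m+n ∣-refl (∈multiplesOf3⇒3∣ x∈)

∣multiplesOf3[k*3]∣≡k : ∀ k → ∣ multiplesOf3 (k * 3) ∣ ≡ k
∣multiplesOf3[k*3]∣≡k zero = refl
∣multiplesOf3[k*3]∣≡k (suc k) = cong suc (∣multiplesOf3[k*3]∣≡k k)

∣multiplesOf3[6q]∣≡2q : ∀ q → ∣ multiplesOf3 (6 * q) ∣ ≡ 2 * q
∣multiplesOf3[6q]∣≡2q q =
  trans (cong (λ n → ∣ multiplesOf3 n ∣) (6q≡2q*3 q)) (∣multiplesOf3[k*3]∣≡k (2 * q))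

multiplesOf3-independent : ∀ q → IsIndependent (KEbar q) (multiplesOf3 (6 * q))
multiplesOf3-independent q x y x∈ y∈ (inj₁ xy) =
  KEEdge⇒¬3∣both xy (∈multiplesOf3⇒3∣ x∈) (∈multiplesOf3⇒3∣ y∈)
multiplesOf3-independent q x y x∈ y∈ (inj₂ yx) =
  KEEdge⇒¬3∣both yx (∈multiplesOf3⇒3∣ y∈) (∈multiplesOf3⇒3∣ x∈)

2+a*3<6q : ∀ {q a} → a < 2 * q → 2 + a * 3 < 6 * q
2+a*3<6q {q} {a} a<2q = subst (2 + a * 3 <_) (sym (6q≡2q*3 q)) (*-monoˡ-≤ 3 a<2q)

triangle-chord : ∀ {q a} → a < 2 * q → KEEdge q (a * 3) (2 + a * 3)
triangle-chord {q} {a} a<2q =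
  subst₂ (KEEdge q) (*-comm 3 a) (trans (+-comm (3 * a) 2) (cong (2 +_) (*-comm 3 a))) (tri a a<2q)

triangle-KEAdj : ∀ {q a} → a < 2 * q → (r s : Fin 3) → r ≢ s →
                 KEAdj q (toℕ r + a * 3) (toℕ s + a * 3)
triangle-KEAdj a<2q zero zero r≢s = contradiction refl r≢s
triangle-KEAdj a<2q (suc zero) (suc zero) r≢s = contradiction refl r≢s
triangle-KEAdj a<2q (suc (suc zero)) (suc (suc zero)) r≢s = contradiction refl r≢s
triangle-KEAdj {q} a<2q zero (suc zero) _ = inj₁ (cyc _ (<⇒≤ (2+a*3<6q {q} a<2q)))
triangle-KEAdj {q} a<2q (suc zero) zero _ = inj₂ (cyc _ (<⇒≤ (2+a*3<6q {q} a<2q)))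
triangle-KEAdj {q} a<2q (suc zero) (suc (suc zero)) _ = inj₁ (cyc _ (2+a*3<6q {q} a<2q))
triangle-KEAdj {q} a<2q (suc (suc zero)) (suc zero) _ = inj₂ (cyc _ (2+a*3<6q {q} a<2q))
triangle-KEAdj a<2q zero (suc (suc zero)) _ = inj₁ (triangle-chord a<2q)
triangle-KEAdj a<2q (suc (suc zero)) zero _ = inj₂ (triangle-chord a<2q)

sameTriangle⇒KEAdj : ∀ {q m n} → m ≢ n → m / 3 ≡ n / 3 → m / 3 < 2 * q → KEAdj q m n
sameTriangle⇒KEAdj {q} {m} {n} m≢n m/3≡n/3 m/3<2q =
  subst₂ (KEAdj q) (sym m≡r+a*3) (sym n≡s+a*3) (triangle-KEAdj m/3<2q (m mod 3) (n mod 3) r≢s)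
  where
  m≡r+a*3 : m ≡ toℕ (m mod 3) + m / 3 * 3
  m≡r+a*3 = DivMod.property (m divMod 3)
  n≡s+a*3 : n ≡ toℕ (n mod 3) + m / 3 * 3
  n≡s+a*3 =
    trans (DivMod.property (n divMod 3)) (cong (λ a → toℕ (n mod 3) + a * 3) (sym m/3≡n/3))
  r≢s : m mod 3 ≢ n mod 3
  r≢s r≡s = m≢n (trans m≡r+a*3 (trans (cong (λ r → toℕ r + m / 3 * 3) r≡s) (sym n≡s+a*3)))

m<6q⇒m/3<2q : ∀ {q m} → m < 6 * q → m / 3 < 2 * q
m<6q⇒m/3<2q {q} {m} m<6q = m<n*o⇒m/o<n (subst (m <_) (6q≡2q*3 q) m<6q)

triangleOf : ∀ q → Fin (6 * q) → Fin (2 * q)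
triangleOf q x = fromℕ< (m<6q⇒m/3<2q {q} (toℕ<n x))

firstVertexOf : ∀ q → Fin (2 * q) → Fin (6 * q)
firstVertexOf q i = fromℕ< (subst (toℕ i * 3 <_) (sym (6q≡2q*3 q)) (*-monoˡ-< 3 (toℕ<n i)))

triangleOf-firstVertexOf : ∀ q i → triangleOf q (firstVertexOf q i) ≡ i
triangleOf-firstVertexOf q i = toℕ-injective (begin
  toℕ (triangleOf q (firstVertexOf q i)) ≡⟨ toℕ-fromℕ< _ ⟩
  toℕ (firstVertexOf q i) / 3             ≡⟨ cong (_/ 3) (toℕ-fromℕ< {m = toℕ i * 3} _) ⟩
  toℕ i * 3 / 3                           ≡⟨ m*n/n≡m (toℕ i) 3 ⟩
  toℕ i                                   ∎)
  where open ≡-Reasoning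

triangleOf-isCliquePartition : ∀ q → IsCliquePartition (KEbar q) (2 * q) (triangleOf q)
triangleOf-isCliquePartition q = surjective , classes-are-cliques
  where
  surjective : Surjective _≡_ _≡_ (triangleOf q)
  surjective i = firstVertexOf q i , λ { refl → triangleOf-firstVertexOf q i }
  classes-are-cliques : ∀ x y → x ≢ y → triangleOf q x ≡ triangleOf q y → KEbar q x y
  classes-are-cliques x y x≢y same = sameTriangle⇒KEAdj (x≢y ∘ toℕ-injective)
    (trans (sym (toℕ-fromℕ< _)) (trans (cong toℕ same) (toℕ-fromℕ< _)))
    (m<6q⇒m/3<2q {q} (toℕ<n x))

theorem13 : ∀ (q : ℕ) → 2 ≤ q →
    CliquePartitionNumber (KEbar q) (2 * q) × IndependenceNumber (KEbar q) (2 * q)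
theorem13 q _ = independent∧cliquePartition⇒θ∧α (KEbar q)
  (multiplesOf3-independent q) (∣multiplesOf3[6q]∣≡2q q) (triangleOf-isCliquePartition q)
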